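{- Let $T$ be a bidirected tree rooted at $z$ and let $R$ be a set of requests in $T$. (i) If $W\subseteq R$ is a set of pairwise interfering converging requests, then there is an in-branch of $T$ containing the reception arcs of all requests in $W$. (ii) If $W\subseteq R$ is a set of pairwise interfering diverging requests, then there is an out-branch of $T$ containing the emission arcs of all requests in $W$.
   Context: A bidirected tree $T$ is a digraph obtained from a finite undirected tree by replacing each edge $uv$ by the two arcs $(u,v)$ and $(v,u)$. A request in $T$ is a directed path in $T$ with at least one arc. For a directed path $r$, $s_r$ is its first vertex, $t_r$ its last vertex, $s_r^+$ its second vertex, $t_r^-$ its penultimate vertex; its emission arc is $(s_r,s_r^+)$ and its reception arc is $(t_r^-,t_r)$. $T[x,y]$ denotes the unique directed path from $x$ to $y$ in $T$. A request $r$ interferes on $r'$ if $T[s_r,t_{r'}]$ has first arc the emission arc of $r$ and last arc the reception arc of $r'$; two requests interfere if one interferes on the other. When $T$ is rooted at $z$, an arc is converging if directed towards $z$ and diverging otherwise; a directed path is converging (resp. diverging) if all its arcs are converging (resp. diverging). An in-branch of the rooted tree is a directed path from a leaf to the root $z$; an out-branch is a directed path from the root $z$ to a leaf. -}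

module Defs where

open import Data.Nat using (ℕ; zero; suc; _≤_)
open import Data.Fin using (Fin)
open import Data.List using (List; []; _∷_; _++_; length)
open import Data.List.Relation.Unary.Unique.Propositional using (Unique)
open import Data.Unit using (⊤)
open import Data.Product using (Σ; ∃; ∃-syntax; _×_)
open import Data.Sum using (_⊎_)
open import Relation.Nullary using (¬_)
open import Relation.Binary.PropositionalEquality using (_≡_; _≢_)

iter : {A : Set} → (A → A) → ℕ → A → A
iter f zero    x = x
iter f (suc k) x = f (iter f k x)

-- A finite tree on the vertex set Fin n, rooted at `root`, encoded by its
-- parent function: the undirected edges are {v , par v} for v ≢ root, and
-- every vertex reaches the root by iterating `par`.  (Every finite tree
-- rooted at z arises uniquely in this way.)
record RootedTree (n : ℕ) : Set where
  field
    root     : Fin n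
    par      : Fin n → Fin n
    par-root : par root ≡ root
    reach    : ∀ v → ∃[ k ] iter par k v ≡ root

module _ {n : ℕ} (T : RootedTree n) where
  open RootedTree T

  Vertex : Set
  Vertex = Fin n

  Arc : Vertex → Vertex → Set
  Arc u v = (u ≢ root × par u ≡ v) ⊎ (v ≢ root × par v ≡ u)

  ConvergingArc : Vertex → Vertex → Set
  ConvergingArc u v = u ≢ root × par u ≡ v

  DivergingArc : Vertex → Vertex → Set
  DivergingArc u v = v ≢ root × par v ≡ u

  Leaf : Vertex → Set
  Leaf v = ∀ w → w ≢ root → par w ≢ v

AllArcs : {A : Set} → (A → A → Set) → List A → Set
AllArcs P []           = ⊤
AllArcs P (x ∷ [])     = ⊤
AllArcs P (x ∷ y ∷ xs) = P x y × AllArcs P (y ∷ xs)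

IsDPath : {n : ℕ} → RootedTree n → List (Fin n) → Set
IsDPath T p = (p ≢ []) × AllArcs (Arc T) p × Unique p

module _ {A : Set} where
  StartsAt : A → List A → Set
  StartsAt x p = ∃[ zs ] p ≡ x ∷ zs

  EndsAt : A → List A → Set
  EndsAt y p = ∃[ ys ] p ≡ ys ++ (y ∷ [])

  FirstArc : A → A → List A → Set
  FirstArc a b p = ∃[ zs ] p ≡ a ∷ b ∷ zs

  LastArc : A → A → List A → Set
  LastArc a b p = ∃[ ys ] p ≡ ys ++ (a ∷ b ∷ [])

  ContainsArc : A → A → List A → Set
  ContainsArc a b p = ∃[ ys ] ∃[ zs ] p ≡ ys ++ (a ∷ b ∷ zs)

record Request {n : ℕ} (T : RootedTree n) : Set where
  field
    path    : List (Fin n)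
    isPath  : IsDPath T path
    nontriv : 2 ≤ length path

open Request public

module _ {n : ℕ} {T : RootedTree n} where

  -- r interferes on r': the path T[s_r , t_r'] has as first arc the emission
  -- arc (a , b) of r and as last arc the reception arc (c , d) of r'.
  -- T[s_r , t_r'] is the (unique) directed path from a = s_r to d = t_r'.
  InterferesOn : Request T → Request T → Set
  InterferesOn r r' =
    ∃[ a ] ∃[ b ] ∃[ c ] ∃[ d ]
      FirstArc a b (path r) × LastArc c d (path r') ×
      (∃[ p ] IsDPath T p × FirstArc a b p × LastArc c d p)

  Interfere : Request T → Request T → Set
  Interfere r r' = InterferesOn r r' ⊎ InterferesOn r' r

  ConvergingReq : Request T → Set
  ConvergingReq r = AllArcs (ConvergingArc T) (path r)

  DivergingReq : Request T → Set
  DivergingReq r = AllArcs (DivergingArc T) (path r)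

InBranch : {n : ℕ} (T : RootedTree n) → List (Fin n) → Set
InBranch T p = IsDPath T p × (∃[ l ] Leaf T l × StartsAt l p) × EndsAt (RootedTree.root T) p

OutBranch : {n : ℕ} (T : RootedTree n) → List (Fin n) → Set
OutBranch T p = IsDPath T p × StartsAt (RootedTree.root T) p × (∃[ l ] Leaf T l × EndsAt l p)

-- Write u ≼ v when u is an ancestor of v. A path of T never descends and then ascends,
-- since both arcs would end at the parent of the middle vertex; so a path whose last arc is
-- converging is converging throughout, and one whose first arc is diverging is diverging
-- throughout. Hence if r interferes on r', then in the converging case the tails t⁻ r, t⁻ r'
-- of both reception arcs are ancestors of s_r, and in the diverging case the heads s⁺ r, s⁺ r'
-- of both emission arcs are ancestors of t_r'. Ancestors of one vertex are comparable, so
-- these vertices form a chain; below its deepest element lies a leaf l, and the path from l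
-- to the root (resp. its reverse) contains the arc between x and par x for every ancestor
-- x ≠ root of l.

module Submission where

open import Defs
open import Data.Nat using (ℕ; zero; suc; _+_; _∸_; _≤_; z≤n; s≤s)
open import Data.Nat.Properties
  using (≤-antisym; ≤-reflexive; ≤-total; <-irrefl; <-trans; 1+n≰n; m∸n+n≡m; n≤0⇒n≡0; suc-injective)
open import Data.Fin using (Fin; _≟_)
open import Data.List using (List; []; _∷_; _++_; _ʳ++_; length; reverse; filter; allFin)
open import Data.List.Properties using (∷-injectiveʳ; ++-ʳ++; ʳ++-defn)
open import Data.List.Relation.Unary.All as All using (All; []; _∷_)
open import Data.List.Relation.Unary.All.Properties using (all-filter)
open import Data.List.Relation.Unary.Any using (here; there)
open import Data.List.Relation.Unary.AllPairs as AllPairs using (_∷_)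
open import Data.List.Relation.Unary.Linked as Linked using (Linked; [-]; _∷_)
open import Data.List.Relation.Unary.Linked.Properties using (Linked⇒AllPairs)
open import Data.List.Relation.Unary.Unique.Propositional using (Unique)
open import Data.List.Membership.Propositional using (_∈_)
open import Data.List.Membership.Propositional.Properties using (∈-++⁺ʳ; ∈-filter⁺; ∈-allFin)
open import Data.List.Extrema.Nat using (argmax; argmax-all; f[xs]≤f[argmax])
import Data.Product as Product
open import Data.Product using (_×_; ∃-syntax; ∃₂; _,_; proj₁; proj₂)
open import Data.Sum using (_⊎_; inj₁; inj₂; [_,_]; swap)
open import Data.Unit using (tt)
open import Function using (_∘_; flip)
open import Relation.Binary.Definitions using (Reflexive; Transitive)
open import Relation.Nullary using (¬_; Dec; yes; no; contradiction)
open import Relation.Nullary.Decidable using (map′)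
open import Relation.Unary using (Decidable)
open import Relation.Binary.PropositionalEquality using (_≡_; _≢_; refl; sym; trans; cong; subst)

leastWitness : ∀ {P : ℕ → Set} → Decidable P → ∀ k → P k →
  ∃[ m ] P m × (∀ {j} → P j → m ≤ j)
leastWitness P? zero p0 = 0 , p0 , λ _ → z≤n
leastWitness P? (suc k) pk with P? 0
... | yes p0 = 0 , p0 , λ _ → z≤n
... | no ¬p0 with leastWitness (P? ∘ suc) k pk
...   | m , pm , m-least =
  suc m , pm , λ { {zero} p0 → contradiction p0 ¬p0 ; {suc j} pj → s≤s (m-least pj) }

module _ {A : Set} (f : A → A) where

  iter-suc : ∀ k x → iter f (suc k) x ≡ iter f k (f x)
  iter-suc zero    x = refl
  iter-suc (suc k) x = cong f (iter-suc k x)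

  iter-+ : ∀ j k x → iter f (j + k) x ≡ iter f j (iter f k x)
  iter-+ zero    k x = refl
  iter-+ (suc j) k x = cong f (iter-+ j k x)

  iter-fixed : ∀ {x} → f x ≡ x → ∀ k → iter f k x ≡ x
  iter-fixed fx≡x zero    = refl
  iter-fixed fx≡x (suc k) = trans (cong f (iter-fixed fx≡x k)) fx≡x

module _ {V X : Set} {_≲_ : V → V → Set} (≲-refl : Reflexive _≲_) (≲-trans : Transitive _≲_) where

  upperBound : (f : X → V) (v : V) (xs : List X) →
    All (λ x → v ≲ f x ⊎ f x ≲ v) xs →
    (∀ {x y} → x ∈ xs → y ∈ xs → f x ≲ f y ⊎ f y ≲ f x) →
    ∃[ u ] v ≲ u × All (λ x → f x ≲ u) xs
  upperBound f v [] _ _ = v , ≲-refl , []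
  upperBound f v (x ∷ xs) (v~x ∷ v~xs) cmp with v~x
  ... | inj₁ v≲fx =
    let u , fx≲u , xs≲u = upperBound f (f x) xs (All.tabulate (cmp (here refl) ∘ there))
                            (λ i j → cmp (there i) (there j))
    in u , ≲-trans v≲fx fx≲u , fx≲u ∷ xs≲u
  ... | inj₂ fx≲v =
    let u , v≲u , xs≲u = upperBound f v xs v~xs (λ i j → cmp (there i) (there j))
    in u , v≲u , ≲-trans fx≲v v≲u ∷ xs≲u

module _ {A : Set} where

  startsAt⇒≢[] : ∀ {x : A} {p} → StartsAt x p → p ≢ []
  startsAt⇒≢[] (_ , refl) ()

  firstArc-exists : ∀ (p : List A) → 2 ≤ length p → ∃₂ λ a b → FirstArc a b p
  firstArc-exists (_ ∷ [])     (s≤s ())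
  firstArc-exists (a ∷ b ∷ zs) _ = a , b , zs , refl

  lastArc-exists : ∀ (p : List A) → 2 ≤ length p → ∃₂ λ c d → LastArc c d p
  lastArc-exists (_ ∷ [])         (s≤s ())
  lastArc-exists (x ∷ y ∷ [])     _ = x , y , [] , refl
  lastArc-exists (x ∷ y ∷ z ∷ zs) _ with lastArc-exists (y ∷ z ∷ zs) (s≤s (s≤s z≤n))
  ... | c , d , ys , e = c , d , x ∷ ys , cong (x ∷_) e

  firstArc-unique : ∀ {a b a' b' : A} {p} → FirstArc a b p → FirstArc a' b' p → a ≡ a' × b ≡ b'
  firstArc-unique (_ , refl) (_ , refl) = refl , refl

  lastArc-tail : ∀ {c d x y z : A} {zs} → LastArc c d (x ∷ y ∷ z ∷ zs) → LastArc c d (y ∷ z ∷ zs)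
  lastArc-tail ([] , ())
  lastArc-tail (_ ∷ ys , e) = ys , ∷-injectiveʳ e

  containsArc-∷ : ∀ {a b x : A} {p} → ContainsArc a b p → ContainsArc a b (x ∷ p)
  containsArc-∷ {x = x} (ys , zs , e) = x ∷ ys , zs , cong (x ∷_) e

  containsArc⇒∈ : ∀ {a b : A} {p} → ContainsArc a b p → a ∈ p
  containsArc⇒∈ (ys , _ , refl) = ∈-++⁺ʳ ys (here refl)

  lastArc⇒containsArc : ∀ {c d : A} {p} → LastArc c d p → ContainsArc c d p
  lastArc⇒containsArc (ys , e) = ys , [] , e

  lastArc⇒∈tail : ∀ {c d x : A} {xs} → LastArc c d (x ∷ xs) → d ∈ xs
  lastArc⇒∈tail ([] , refl) = here refl
  lastArc⇒∈tail (_ ∷ ys , refl) = ∈-++⁺ʳ ys (there (here refl))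

  endsAt⇒∈ : ∀ {x : A} {p} → EndsAt x p → x ∈ p
  endsAt⇒∈ (ys , refl) = ∈-++⁺ʳ ys (here refl)

  reverse-middle : ∀ (ys : List A) x y zs →
    reverse (ys ++ x ∷ y ∷ zs) ≡ reverse zs ++ y ∷ x ∷ reverse ys
  reverse-middle ys x y zs = trans (++-ʳ++ ys) (ʳ++-defn zs)

  containsArc-reverse : ∀ {a b : A} {p} → ContainsArc a b p → ContainsArc b a (reverse p)
  containsArc-reverse {a} {b} (ys , zs , refl) = reverse zs , reverse ys , reverse-middle ys a b zs

  lastArc-reverse : ∀ {c d : A} {p} → LastArc c d p → FirstArc d c (reverse p)
  lastArc-reverse {c} {d} (ys , refl) = reverse ys , reverse-middle ys c d []

  lastArc-unique : ∀ {c d c' d' : A} {p} → LastArc c d p → LastArc c' d' p → c ≡ c' × d ≡ d'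
  lastArc-unique la la' = Product.swap (firstArc-unique (lastArc-reverse la) (lastArc-reverse la'))

  startsAt-reverse : ∀ {x : A} {p} → StartsAt x p → EndsAt x (reverse p)
  startsAt-reverse (zs , refl) = reverse zs , ʳ++-defn zs

  endsAt-reverse : ∀ {x : A} {p} → EndsAt x p → StartsAt x (reverse p)
  endsAt-reverse (ys , refl) = reverse ys , ++-ʳ++ ys

  allArcs-map : ∀ {P Q : A → A → Set} → (∀ {x y} → P x y → Q x y) →
    ∀ {p} → AllArcs P p → AllArcs Q p
  allArcs-map P⇒Q {[]}         _          = tt
  allArcs-map P⇒Q {_ ∷ []}     _          = tt
  allArcs-map P⇒Q {_ ∷ _ ∷ _} (pxy , ps) = P⇒Q pxy , allArcs-map P⇒Q ps

  allArcs-∷ : ∀ {P : A → A → Set} {x y p} → StartsAt y p → P x y → AllArcs P p → AllArcs P (x ∷ p)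
  allArcs-∷ (_ , refl) pxy ps = pxy , ps

  allArcs-firstArc : ∀ {P : A → A → Set} {a b p} → AllArcs P p → FirstArc a b p → P a b
  allArcs-firstArc ps (_ , refl) = proj₁ ps

  allArcs-lastArc : ∀ {P : A → A → Set} {c d p} → AllArcs P p → LastArc c d p → P c d
  allArcs-lastArc         ps ([] , refl)         = proj₁ ps
  allArcs-lastArc {P = P} ps (_ ∷ [] , refl)     = allArcs-lastArc {P = P} (proj₂ ps) ([] , refl)
  allArcs-lastArc {P = P} ps (_ ∷ y ∷ ys , refl) =
    allArcs-lastArc {P = P} (proj₂ ps) (y ∷ ys , refl)

  allArcs-ʳ++ : ∀ {P : A → A → Set} {x} xs {acc} →
    AllArcs (flip P) (x ∷ xs) → AllArcs P (x ∷ acc) → AllArcs P (xs ʳ++ x ∷ acc)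
  allArcs-ʳ++ []       _          pacc = pacc
  allArcs-ʳ++ (y ∷ ys) (pyx , ps) pacc = allArcs-ʳ++ ys ps (pyx , pacc)

  allArcs-reverse : ∀ {P : A → A → Set} {p} → AllArcs P p → AllArcs (flip P) (reverse p)
  allArcs-reverse {p = []}     _  = tt
  allArcs-reverse {p = x ∷ xs} ps = allArcs-ʳ++ xs ps tt

  allArcs⇒linked : ∀ {P : A → A → Set} {p} → AllArcs P p → Linked P p
  allArcs⇒linked {p = []}         _          = Linked.[]
  allArcs⇒linked {p = _ ∷ []}     _          = [-]
  allArcs⇒linked {p = _ ∷ _ ∷ _} (pxy , ps) = pxy ∷ allArcs⇒linked ps

  allArcs-unique : ∀ {P R : A → A → Set} → Transitive R → (∀ {x} → ¬ R x x) →
    (∀ {x y} → P x y → R x y) → ∀ {p} → AllArcs P p → Unique p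
  allArcs-unique {R = R} R-trans R-irrefl P⇒R ps =
    AllPairs.map (λ { rxy refl → R-irrefl rxy })
      (Linked⇒AllPairs {R = R} R-trans (Linked.map P⇒R (allArcs⇒linked ps)))

  allArcs-forward : ∀ {R Q : A → A → Set} → (∀ {x y z} → Q x y → R y z → x ≢ z → Q y z) →
    ∀ {a b p} → Unique p → AllArcs R p → FirstArc a b p → Q a b → AllArcs Q p
  allArcs-forward step {p = _ ∷ _ ∷ []}     _                   _          (_ , refl) q = q , tt
  allArcs-forward step {p = _ ∷ _ ∷ _ ∷ _} ((_ ∷ x≢z ∷ _) ∷ u) (_ , rs) (_ , refl) q =
    q , allArcs-forward step u rs (_ , refl) (step q (proj₁ rs) x≢z)

  allArcs-backward : ∀ {R Q : A → A → Set} → (∀ {x y z} → R x y → Q y z → x ≢ z → Q x y) →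
    ∀ {c d p} → Unique p → AllArcs R p → LastArc c d p → Q c d → AllArcs Q p
  allArcs-backward step {p = []}         _ _ _ _ = tt
  allArcs-backward step {p = _ ∷ []}     _ _ _ _ = tt
  allArcs-backward step {p = _ ∷ _ ∷ []} _ _ la q with lastArc-unique la ([] , refl)
  ... | refl , refl = q , tt
  allArcs-backward step {p = _ ∷ _ ∷ _ ∷ _} ((_ ∷ x≢z ∷ _) ∷ u) (rxy , rs) la q =
    let qs = allArcs-backward step u rs (lastArc-tail la) q
    in step rxy (proj₁ qs) x≢z , qs

module _ {n : ℕ} (T : RootedTree n) where
  open RootedTree T

  infix 4 _≼_ _≼?_

  _≼_ : Fin n → Fin n → Set
  u ≼ v = ∃[ k ] iter par k v ≡ u

  ≼-refl : Reflexive _≼_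
  ≼-refl = 0 , refl

  ≼-trans : Transitive _≼_
  ≼-trans (j , refl) (k , refl) = j + k , iter-+ par j k _

  par-≼ : ∀ v → par v ≼ v
  par-≼ v = 1 , refl

  root-≼ : ∀ v → root ≼ v
  root-≼ = reach

  iter-≤⇒≼ : ∀ {i j} v → i ≤ j → iter par j v ≼ iter par i v
  iter-≤⇒≼ {i} {j} v i≤j =
    j ∸ i , trans (sym (iter-+ par (j ∸ i) i v)) (cong (λ m → iter par m v) (m∸n+n≡m i≤j))

  ≼-total-below : ∀ {u v w} → u ≼ w → v ≼ w → u ≼ v ⊎ v ≼ u
  ≼-total-below {w = w} (i , refl) (j , refl) with ≤-total i j
  ... | inj₁ i≤j = inj₂ (iter-≤⇒≼ w i≤j)
  ... | inj₂ j≤i = inj₁ (iter-≤⇒≼ w j≤i)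

  depthWitness : ∀ v → ∃[ m ] iter par m v ≡ root × (∀ {k} → iter par k v ≡ root → m ≤ k)
  depthWitness v = leastWitness (λ k → iter par k v ≟ root) (proj₁ (reach v)) (proj₂ (reach v))

  depth : Fin n → ℕ
  depth v = proj₁ (depthWitness v)

  depth-reaches-root : ∀ v → iter par (depth v) v ≡ root
  depth-reaches-root v = proj₁ (proj₂ (depthWitness v))

  depth-least : ∀ {v k} → iter par k v ≡ root → depth v ≤ k
  depth-least {v} = proj₂ (proj₂ (depthWitness v))

  depth≡0⇒root : ∀ {v} → depth v ≡ 0 → v ≡ root
  depth≡0⇒root {v} e = subst (λ m → iter par m v ≡ root) e (depth-reaches-root v)

  depth-par : ∀ {v} → v ≢ root → depth v ≡ suc (depth (par v))
  depth-par {v} v≢root = ≤-antisym upper lower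
    where
    upper : depth v ≤ suc (depth (par v))
    upper = depth-least (trans (iter-suc par (depth (par v)) v) (depth-reaches-root (par v)))
    lower : suc (depth (par v)) ≤ depth v
    lower with depth v | depth-reaches-root v
    ... | zero  | v≡root  = contradiction v≡root v≢root
    ... | suc k | reaches = s≤s (depth-least (trans (sym (iter-suc par k v)) reaches))

  depth-suc : ∀ {v k} → depth v ≡ suc k → v ≢ root × depth (par v) ≡ k
  depth-suc {v} {k} e = v≢root , suc-injective (trans (sym (depth-par v≢root)) e)
    where
    v≢root : v ≢ root
    v≢root refl with () ← trans (sym e) (n≤0⇒n≡0 (depth-least {root} {0} refl))

  converging-depth : ∀ {u v} → ConvergingArc T u v → depth u ≡ suc (depth v)
  converging-depth (u≢root , refl) = depth-par u≢root

  converging⇒unique : ∀ {p} → AllArcs (ConvergingArc T) p → Unique p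
  converging⇒unique =
    allArcs-unique (flip <-trans) (<-irrefl refl) (≤-reflexive ∘ sym ∘ converging-depth)

  -- DivergingArc T u v unfolds to ConvergingArc T v u.
  diverging⇒unique : ∀ {p} → AllArcs (DivergingArc T) p → Unique p
  diverging⇒unique =
    allArcs-unique <-trans (<-irrefl refl) (≤-reflexive ∘ sym ∘ converging-depth)

  converging-∈⇒≼ : ∀ {x y p} → AllArcs (ConvergingArc T) p → StartsAt x p → y ∈ p → y ≼ x
  converging-∈⇒≼ _ (_ , refl) (here refl) = ≼-refl
  converging-∈⇒≼ {p = x ∷ z ∷ zs} ((_ , refl) , cs) (_ , refl) (there y∈) =
    ≼-trans (converging-∈⇒≼ cs (_ , refl) y∈) (par-≼ x)

  diverging-∈⇒≽ : ∀ {x y p} → AllArcs (DivergingArc T) p → StartsAt x p → y ∈ p → x ≼ y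
  diverging-∈⇒≽ _ (_ , refl) (here refl) = ≼-refl
  diverging-∈⇒≽ {p = x ∷ z ∷ zs} ((_ , refl) , ds) (_ , refl) (there y∈) =
    ≼-trans (par-≼ z) (diverging-∈⇒≽ ds (_ , refl) y∈)

  ascent : ℕ → Fin n → List (Fin n)
  ascent zero    v = v ∷ []
  ascent (suc k) v = v ∷ ascent k (par v)

  ascent-startsAt : ∀ k v → StartsAt v (ascent k v)
  ascent-startsAt zero    v = [] , refl
  ascent-startsAt (suc k) v = ascent k (par v) , refl

  ascent-converging : ∀ {k v} → depth v ≡ k → AllArcs (ConvergingArc T) (ascent k v)
  ascent-converging {zero}  _ = tt
  ascent-converging {suc k} {v} e =
    let v≢root , e′ = depth-suc e
    in allArcs-∷ (ascent-startsAt k (par v)) (v≢root , refl) (ascent-converging e′)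

  ascent-endsAt-root : ∀ {k v} → depth v ≡ k → EndsAt root (ascent k v)
  ascent-endsAt-root {zero} e with refl ← depth≡0⇒root e = [] , refl
  ascent-endsAt-root {suc k} {v} e =
    let ys , ys-end = ascent-endsAt-root (proj₂ (depth-suc e)) in v ∷ ys , cong (v ∷_) ys-end

  ascent-containsArc : ∀ {k u v w} → depth v ≡ k → u ≼ v → ConvergingArc T u w →
    ContainsArc u w (ascent k v)
  ascent-containsArc {zero} {v = v} e (i , refl) (u≢root , _) with refl ← depth≡0⇒root e =
    contradiction (iter-fixed par par-root i) u≢root
  ascent-containsArc {suc k} {v = v} e (zero , refl) (_ , refl) =
    let zs , e′ = ascent-startsAt k (par v) in [] , zs , cong (v ∷_) e′
  ascent-containsArc {suc k} {v = v} e (suc i , refl) uw =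
    containsArc-∷ (ascent-containsArc (proj₂ (depth-suc e)) (i , sym (iter-suc par i v)) uw)

  toRoot : Fin n → List (Fin n)
  toRoot v = ascent (depth v) v

  fromRoot : Fin n → List (Fin n)
  fromRoot v = reverse (toRoot v)

  toRoot-converging : ∀ v → AllArcs (ConvergingArc T) (toRoot v)
  toRoot-converging v = ascent-converging refl

  toRoot-containsArc : ∀ {u v w} → u ≼ v → ConvergingArc T u w → ContainsArc u w (toRoot v)
  toRoot-containsArc = ascent-containsArc refl

  fromRoot-containsArc : ∀ {u v w} → w ≼ v → DivergingArc T u w → ContainsArc u w (fromRoot v)
  fromRoot-containsArc w≼v uw = containsArc-reverse (toRoot-containsArc w≼v uw)

  ≼⇒∈toRoot : ∀ {u v} → u ≼ v → u ∈ toRoot v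
  ≼⇒∈toRoot {u} {v} u≼v with u ≟ root
  ... | yes refl    = endsAt⇒∈ (ascent-endsAt-root refl)
  ... | no  u≢root = containsArc⇒∈ (toRoot-containsArc u≼v (u≢root , refl))

  _≼?_ : ∀ u v → Dec (u ≼ v)
  u ≼? v =
    map′ (converging-∈⇒≼ (toRoot-converging v) (ascent-startsAt _ v)) ≼⇒∈toRoot (u ∈? toRoot v)
    where open import Data.List.Membership.DecPropositional (_≟_ {n}) using (_∈?_)

  -- A deepest descendant of u has no children.
  leaf-below : ∀ u → ∃[ l ] Leaf T l × u ≼ l
  leaf-below u = l , l-leaf , u≼l
    where
    descendants : List (Fin n)
    descendants = filter (u ≼?_) (allFin n)
    l : Fin n
    l = argmax depth u descendants
    u≼l : u ≼ l
    u≼l = argmax-all depth ≼-refl (all-filter (u ≼?_) (allFin n))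
    l-leaf : Leaf T l
    l-leaf w w≢root pw≡l =
      1+n≰n (subst (_≤ depth l) (trans (depth-par w≢root) (cong (suc ∘ depth) pw≡l)) w-shallower)
      where
      w-shallower : depth w ≤ depth l
      w-shallower = All.lookup (f[xs]≤f[argmax] u descendants)
                      (∈-filter⁺ (u ≼?_) (∈-allFin w) (≼-trans u≼l (1 , pw≡l)))

  toRoot-inBranch : ∀ {l} → Leaf T l → InBranch T (toRoot l)
  toRoot-inBranch {l} l-leaf =
    (startsAt⇒≢[] (ascent-startsAt _ l) , allArcs-map inj₁ conv , converging⇒unique conv) ,
    (l , l-leaf , ascent-startsAt _ l) , ascent-endsAt-root refl
    where
    conv : AllArcs (ConvergingArc T) (toRoot l)
    conv = toRoot-converging l

  fromRoot-outBranch : ∀ {l} → Leaf T l → OutBranch T (fromRoot l)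
  fromRoot-outBranch {l} l-leaf =
    (startsAt⇒≢[] starts , allArcs-map inj₂ div , diverging⇒unique div) ,
    starts , (l , l-leaf , startsAt-reverse (ascent-startsAt (depth l) l))
    where
    div : AllArcs (DivergingArc T) (fromRoot l)
    div = allArcs-reverse (toRoot-converging l)
    starts : StartsAt root (fromRoot l)
    starts = endsAt-reverse (ascent-endsAt-root refl)

  leaf-below-all : ∀ {X : Set} (f : X → Fin n) (xs : List X) →
    (∀ {x y} → x ∈ xs → y ∈ xs → f x ≼ f y ⊎ f y ≼ f x) →
    ∃[ l ] Leaf T l × All (λ x → f x ≼ l) xs
  leaf-below-all f xs cmp =
    let v , _ , xs≼v =
          upperBound ≼-refl ≼-trans f root xs (All.universal (inj₁ ∘ root-≼ ∘ f) xs) cmp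
        l , l-leaf , v≼l = leaf-below v
    in l , l-leaf , All.map (λ x≼v → ≼-trans x≼v v≼l) xs≼v

  arc-before-converging : ∀ {x y z} → Arc T x y → ConvergingArc T y z → x ≢ z → ConvergingArc T x y
  arc-before-converging (inj₁ xy) _ _ = xy
  arc-before-converging (inj₂ (_ , py≡x)) (_ , py≡z) x≢z = contradiction (trans (sym py≡x) py≡z) x≢z

  arc-after-diverging : ∀ {x y z} → DivergingArc T x y → Arc T y z → x ≢ z → DivergingArc T y z
  arc-after-diverging _ (inj₂ yz) _ = yz
  arc-after-diverging (_ , py≡x) (inj₁ (_ , py≡z)) x≢z = contradiction (trans (sym py≡x) py≡z) x≢z

  converging-lastArc⇒≼first : ∀ {p a b c d} → IsDPath T p → FirstArc a b p → LastArc c d p →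
    ConvergingArc T c d → c ≼ a
  converging-lastArc⇒≼first (_ , arcs , u) (_ , refl) la cd =
    converging-∈⇒≼ (allArcs-backward arc-before-converging u arcs la cd) (_ , refl)
      (containsArc⇒∈ (lastArc⇒containsArc la))

  diverging-firstArc⇒≼last : ∀ {p a b c d} → IsDPath T p → FirstArc a b p → LastArc c d p →
    DivergingArc T a b → b ≼ d
  diverging-firstArc⇒≼last (_ , arcs , u) fa@(_ , refl) la ab =
    diverging-∈⇒≽ (proj₂ (allArcs-forward arc-after-diverging u arcs fa ab)) (_ , refl)
      (lastArc⇒∈tail la)

  s⁺ : Request T → Fin n
  s⁺ r = proj₁ (proj₂ (firstArc-exists (path r) (nontriv r)))

  s⁺-firstArc : ∀ r → ∃[ a ] FirstArc a (s⁺ r) (path r)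
  s⁺-firstArc r = let a , _ , fa = firstArc-exists (path r) (nontriv r) in a , fa

  s⁺-unique : ∀ r {a b} → FirstArc a b (path r) → b ≡ s⁺ r
  s⁺-unique r fa = proj₂ (firstArc-unique fa (proj₂ (s⁺-firstArc r)))

  t⁻ : Request T → Fin n
  t⁻ r = proj₁ (lastArc-exists (path r) (nontriv r))

  t⁻-lastArc : ∀ r → ∃[ d ] LastArc (t⁻ r) d (path r)
  t⁻-lastArc r = proj₂ (lastArc-exists (path r) (nontriv r))

  t⁻-unique : ∀ r {c d} → LastArc c d (path r) → c ≡ t⁻ r
  t⁻-unique r la = proj₁ (lastArc-unique la (proj₂ (t⁻-lastArc r)))

  interferesOn-converging : ∀ r r' → ConvergingReq r → ConvergingReq r' → InterferesOn r r' →
    t⁻ r ≼ t⁻ r' ⊎ t⁻ r' ≼ t⁻ r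
  interferesOn-converging r r' cr cr'
    (a , _ , _ , _ , r-first , r'-last , _ , p-path , p-first , p-last) =
    ≼-total-below t⁻r≼a t⁻r'≼a
    where
    t⁻r≼a : t⁻ r ≼ a
    t⁻r≼a = let _ , r-last = t⁻-lastArc r in
      converging-lastArc⇒≼first (isPath r) r-first r-last (allArcs-lastArc cr r-last)
    t⁻r'≼a : t⁻ r' ≼ a
    t⁻r'≼a = subst (_≼ a) (t⁻-unique r' r'-last)
      (converging-lastArc⇒≼first p-path p-first p-last (allArcs-lastArc cr' r'-last))

  interferesOn-diverging : ∀ r r' → DivergingReq r → DivergingReq r' → InterferesOn r r' →
    s⁺ r ≼ s⁺ r' ⊎ s⁺ r' ≼ s⁺ r
  interferesOn-diverging r r' dr dr'
    (_ , _ , _ , d , r-first , r'-last , _ , p-path , p-first , p-last) =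
    ≼-total-below s⁺r≼d s⁺r'≼d
    where
    s⁺r≼d : s⁺ r ≼ d
    s⁺r≼d = subst (_≼ d) (s⁺-unique r r-first)
      (diverging-firstArc⇒≼last p-path p-first p-last (allArcs-firstArc dr r-first))
    s⁺r'≼d : s⁺ r' ≼ d
    s⁺r'≼d = let _ , r'-first = s⁺-firstArc r' in
      diverging-firstArc⇒≼last (isPath r') r'-first r'-last (allArcs-firstArc dr' r'-first)

  interfere-converging : ∀ r r' → ConvergingReq r → ConvergingReq r' → Interfere r r' →
    t⁻ r ≼ t⁻ r' ⊎ t⁻ r' ≼ t⁻ r
  interfere-converging r r' cr cr' =
    [ interferesOn-converging r r' cr cr' , swap ∘ interferesOn-converging r' r cr' cr ]

  interfere-diverging : ∀ r r' → DivergingReq r → DivergingReq r' → Interfere r r' →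
    s⁺ r ≼ s⁺ r' ⊎ s⁺ r' ≼ s⁺ r
  interfere-diverging r r' dr dr' =
    [ interferesOn-diverging r r' dr dr' , swap ∘ interferesOn-diverging r' r dr' dr ]

  toRoot-containsReception : ∀ r {l} → ConvergingReq r → t⁻ r ≼ l →
    ∀ c d → LastArc c d (path r) → ContainsArc c d (toRoot l)
  toRoot-containsReception r {l} cr t⁻r≼l c d la =
    toRoot-containsArc (subst (_≼ l) (sym (t⁻-unique r la)) t⁻r≼l) (allArcs-lastArc cr la)

  fromRoot-containsEmission : ∀ r {l} → DivergingReq r → s⁺ r ≼ l →
    ∀ a b → FirstArc a b (path r) → ContainsArc a b (fromRoot l)
  fromRoot-containsEmission r {l} dr s⁺r≼l a b fa =
    fromRoot-containsArc (subst (_≼ l) (sym (s⁺-unique r fa)) s⁺r≼l) (allArcs-firstArc dr fa)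

  PairwiseInterfering : List (Request T) → Set
  PairwiseInterfering W = ∀ {r r'} → r ∈ W → r' ∈ W → Interfere r r'

  inBranch-containing-receptions : ∀ W → All ConvergingReq W → PairwiseInterfering W →
    ∃[ p ] InBranch T p × All (λ r → ∀ c d → LastArc c d (path r) → ContainsArc c d p) W
  inBranch-containing-receptions W conv interfering =
    let l , l-leaf , t⁻≼l = leaf-below-all t⁻ W λ {r} {r'} r∈ r'∈ →
          interfere-converging r r' (All.lookup conv r∈) (All.lookup conv r'∈) (interfering r∈ r'∈)
    in toRoot l , toRoot-inBranch l-leaf ,
       All.zipWith (λ {r} (cr , t⁻r≼l) → toRoot-containsReception r cr t⁻r≼l) (conv , t⁻≼l)

  outBranch-containing-emissions : ∀ W → All DivergingReq W → PairwiseInterfering W →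
    ∃[ p ] OutBranch T p × All (λ r → ∀ a b → FirstArc a b (path r) → ContainsArc a b p) W
  outBranch-containing-emissions W div interfering =
    let l , l-leaf , s⁺≼l = leaf-below-all s⁺ W λ {r} {r'} r∈ r'∈ →
          interfere-diverging r r' (All.lookup div r∈) (All.lookup div r'∈) (interfering r∈ r'∈)
    in fromRoot l , fromRoot-outBranch l-leaf ,
       All.zipWith (λ {r} (dr , s⁺r≼l) → fromRoot-containsEmission r dr s⁺r≼l) (div , s⁺≼l)

corollary2 : {n : ℕ} (T : RootedTree n) (R : List (Request T)) (W : List (Request T))
    → All (_∈ R) W
    → (All ConvergingReq W
        → (∀ {r r'} → r ∈ W → r' ∈ W → Interfere r r')
        → ∃[ p ] InBranch T p × All (λ r → ∀ c d → LastArc c d (path r) → ContainsArc c d p) W)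
    × (All DivergingReq W
        → (∀ {r r'} → r ∈ W → r' ∈ W → Interfere r r')
        → ∃[ p ] OutBranch T p × All (λ r → ∀ a b → FirstArc a b (path r) → ContainsArc a b p) W)
corollary2 T _ W _ = inBranch-containing-receptions T W , outBranch-containing-emissions T W
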